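{- Let $p$ be a prime, $n\in\mathbb{Z}^+$, and let $i,d\in[0,n]$ with $\ell=\ell_p(d)=\lceil\log_p(d+1)\rceil$. Then, over $\mathbb{F}_p$, \[ \operatorname{Z\text{ - }cl}_{n,d}(i)=\begin{cases}\{i\},& i\notin[d,n-d],\\ i\oplus p^\ell,& i\in[d,n-d],\end{cases} \] where $i\oplus p^\ell=\{t\in[0,n]: t\equiv i \pmod{p^\ell}\}$.
   Context: For integers $a\le b$, $[a,b]$ denotes the set of integers between $a$ and $b$. Work over the field $\mathbb{F}_p$ and view $\{0,1\}^n\subseteq\mathbb{F}_p^n$. For $x\in\{0,1\}^n$, $|x|$ is its Hamming weight (number of coordinates equal to $1$). For $E\subseteq[0,n]$ let $\underline{E}=\{x\in\{0,1\}^n:|x|\in E\}$. For $S\subseteq\{0,1\}^n$ and $d\in[0,n]$, the degree-$d$ Zariski closure $\operatorname{Z\text{ - }cl}_{n,d}(S)$ is the set of all $y\in\{0,1\}^n$ such that every polynomial $f\in\mathbb{F}_p[X_1,\dots,X_n]$ with $\deg f\le d$ vanishing on all of $S$ also vanishes at $y$. For $S=\underline{E}$ this set is symmetric, and is identified with the set $\{|y|: y\in\operatorname{Z\text{ - }cl}_{n,d}(\underline{E})\}\subseteq[0,n]$; this subset is denoted $\operatorname{Z\text{ - }cl}_{n,d}(E)$, and $\operatorname{Z\text{ - }cl}_{n,d}(i)$ means $\operatorname{Z\text{ - }cl}_{n,d}(\{i\})$. -}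

module Defs where

open import Data.Nat using (ℕ; zero; suc; _+_; _*_; _^_; _≤_; _<_)
open import Data.Bool using (Bool; true; false; if_then_else_)
open import Data.Vec using (Vec; []; _∷_)
import Data.Vec as V
open import Data.List using (List)
import Data.List as L
open import Data.Nat.ListAction using (sum)
open import Data.Product using (Σ; _×_; _,_; ∃; proj₂)
open import Data.List.Relation.Unary.All using (All)
open import Relation.Binary.PropositionalEquality using (_≡_)
open import Data.Nat.Divisibility using (_∣_)
open import Data.Integer using (ℤ; +_; _-_)
import Data.Integer.Divisibility as ℤD

weight : ∀ {n} → Vec Bool n → ℕ
weight [] = 0
weight (b ∷ xs) = (if b then 1 else 0) + weight xs

bit : Bool → ℕ
bit true = 1
bit false = 0

-- A polynomial in F_p[X_1..X_n]: finite list of terms (c , e) meaning c · X^e,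
-- where the coefficient c ∈ ℕ represents its residue class in F_p and
-- e is the exponent vector.
Poly : ℕ → Set
Poly n = List (ℕ × Vec ℕ n)

monoDeg : ∀ {n} → Vec ℕ n → ℕ
monoDeg es = V.sum es

DegLe : ∀ {n} → Poly n → ℕ → Set
DegLe f d = All (λ t → monoDeg (proj₂ t) ≤ d) f

evalMono : ∀ {n} → Vec ℕ n → Vec ℕ n → ℕ
evalMono [] [] = 1
evalMono (e ∷ es) (a ∷ as) = a ^ e * evalMono es as

-- value of f at a point (computed in ℕ; its residue mod p is the value in F_p)
evalPoly : ∀ {n} → Poly n → Vec ℕ n → ℕ
evalPoly f a = sum (L.map (λ { (c , e) → c * evalMono e a }) f)

VanishesAt : ℕ → ∀ {n} → Poly n → Vec Bool n → Set
VanishesAt p f x = p ∣ evalPoly f (V.map bit x)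

ZCl : (p n d : ℕ) → (Vec Bool n → Set) → Vec Bool n → Set
ZCl p n d S y =
  (f : Poly n) → DegLe f d → ((x : Vec Bool n) → S x → VanishesAt p f x) → VanishesAt p f y

ZClW : (p n d : ℕ) → (ℕ → Set) → ℕ → Set
ZClW p n d E t = Σ (Vec Bool n) (λ y → weight y ≡ t × ZCl p n d (λ x → E (weight x)) y)

_≡_[mod_] : ℕ → ℕ → ℕ → Set
t ≡ i [mod m ] = (+ m) ℤD.∣ ((+ t) - (+ i))

-- ℓ = ℓ_p(d) = ⌈log_p(d+1)⌉, i.e. the least ℓ with d + 1 ≤ p^ℓ
IsCeilLog : (p d ℓ : ℕ) → Set
IsCeilLog p d ℓ = (suc d ≤ p ^ ℓ) × ((k : ℕ) → k < ℓ → p ^ k < suc d)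

{-# OPTIONS --safe #-}
module Submission where

-- The elementary symmetric polynomial e_k takes the value C(|x|, k) on the cube, so for k ≤ d
-- every point y of the closure of the i-th slice has C(|y|, k) ≡ C(i, k) (mod p). Since p^k ≤ d
-- for k < ℓ and C(t, p^k) mod p is the k-th base-p digit of t (rows of Pascal's triangle are
-- p^ℓ-periodic mod p), this forces |y| ≡ i (mod p^ℓ). For i < d, the monomial of an (i+1)-subset
-- of y (if |y| > i) or ∏_{j∈y} X_j · ∑_{k ≤ i−|y|} (−1)^k e_k(X_j : j ∉ y) (if |y| < i) vanishes on
-- the slice but not at y, so |y| = i; i > n − d follows by complementing all coordinates.
-- Conversely, for d ≤ i ≤ n − d, fixing the first coordinate reduces n until i = d or i = n − d
-- (the latter again by complementation). For i = d and |y| = d + q p^ℓ, summing a polynomial f of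
-- degree ≤ d over the d-subsets of y counts each monomial X^e with supp e ⊆ y exactly
-- C(|y| − |e|, d − |e|) ≡ 1 times, so that sum is f(y) modulo p.

open import Defs
open import Data.Bool using (Bool; true; false; _∧_; not)
open import Data.Empty using (⊥-elim)
import Data.Integer as ℤ
import Data.Integer.Properties as ℤP
open import Data.List using (List; []; _∷_; _++_; map)
open import Data.List.Properties using (map-++; map-∘; map-cong)
open import Data.List.Relation.Unary.All using (All; []; _∷_)
import Data.List.Relation.Unary.All as All
import Data.List.Relation.Unary.All.Properties as AllP
open import Data.Nat
open import Data.Nat.Combinatorics using (_C_; nCk+nC[k+1]≡[n+1]C[k+1]; k>n⇒nCk≡0; nCn≡1; nC1≡n)
open import Data.Nat.Divisibility using (_∣_; divides; _∣0; ∣1⇒≡1; ∣m+n∣m⇒∣n; n∣m*n; m∣m*n; *-cancelˡ-∣; ∣-trans)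
open import Data.Nat.DivMod using (_%_; _/_; m≡m%n+[m/n]*n; [m+kn]%n≡m%n; m%n<n)
open import Data.Nat.ListAction using (sum)
open import Data.Nat.ListAction.Properties using (sum-++)
open import Data.Nat.Primality using (Prime; euclidsLemma; prime⇒nonZero; ¬prime[1])
open import Data.Nat.Properties
open import Data.Nat.Tactic.RingSolver using (solve-∀)
open import Data.Product using (Σ; ∃; ∃₂; _×_; _,_; proj₁; proj₂)
open import Data.Sum using (_⊎_; inj₁; inj₂)
open import Data.Vec using (Vec; []; _∷_)
import Data.Vec as V
open import Function using (_∘_)
open import Function.Bundles using (_⇔_; mk⇔)
open import Level using (0ℓ)
open import Relation.Binary.Bundles using (Setoid)
open import Relation.Binary.PropositionalEquality
import Relation.Binary.Reasoning.Setoid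
open import Relation.Binary.Structures using (IsEquivalence)
open import Relation.Nullary using (¬_; yes; no)

-- Congruence modulo M

infix 4 _≈[_]_
_≈[_]_ : ℕ → ℕ → ℕ → Set
a ≈[ M ] b = ∃₂ λ k l → a + k * M ≡ b + l * M

module _ {M : ℕ} where

  ≈-refl : ∀ {a} → a ≈[ M ] a
  ≈-refl = 0 , 0 , refl

  ≈-reflexive : ∀ {a b} → a ≡ b → a ≈[ M ] b
  ≈-reflexive refl = ≈-refl

  ≈-sym : ∀ {a b} → a ≈[ M ] b → b ≈[ M ] a
  ≈-sym (k , l , e) = l , k , sym e

  ≈-trans : ∀ {a b c} → a ≈[ M ] b → b ≈[ M ] c → a ≈[ M ] c
  ≈-trans {a} {b} {c} (k , l , e) (k′ , l′ , e′) = k + k′ , l′ + l , (begin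
    a + (k + k′) * M     ≡⟨ split a k k′ M ⟩
    (a + k * M) + k′ * M  ≡⟨ cong (_+ k′ * M) e ⟩
    (b + l * M) + k′ * M  ≡⟨ swap b l k′ M ⟩
    (b + k′ * M) + l * M  ≡⟨ cong (_+ l * M) e′ ⟩
    (c + l′ * M) + l * M  ≡⟨ split c l′ l M ⟨
    c + (l′ + l) * M      ∎)
    where
    open ≡-Reasoning
    split : ∀ a k k′ M → a + (k + k′) * M ≡ a + k * M + k′ * M
    split = solve-∀
    swap : ∀ b l k′ M → b + l * M + k′ * M ≡ b + k′ * M + l * M
    swap = solve-∀

  ≈-isEquivalence : IsEquivalence (_≈[ M ]_)
  ≈-isEquivalence = record { refl = ≈-refl ; sym = ≈-sym ; trans = ≈-trans }

  ≈-+ : ∀ {a b c d} → a ≈[ M ] b → c ≈[ M ] d → a + c ≈[ M ] b + d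
  ≈-+ {a} {b} {c} {d} (k , l , e) (k′ , l′ , e′) =
    k + k′ , l + l′ , trans (regroup a c k k′ M) (trans (cong₂ _+_ e e′) (sym (regroup b d l l′ M)))
    where
    regroup : ∀ a c k k′ M → a + c + (k + k′) * M ≡ (a + k * M) + (c + k′ * M)
    regroup = solve-∀

  ≈-* : ∀ {a b c d} → a ≈[ M ] b → c ≈[ M ] d → a * c ≈[ M ] b * d
  ≈-* {a} {b} {c} {d} (k , l , e) (k′ , l′ , e′) =
    k * c + a * k′ + k * k′ * M , l * d + b * l′ + l * l′ * M ,
    trans (expand a c k k′ M) (trans (cong₂ _*_ e e′) (sym (expand b d l l′ M)))
    where
    expand : ∀ a c k k′ M → a * c + (k * c + a * k′ + k * k′ * M) * M ≡ (a + k * M) * (c + k′ * M)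
    expand = solve-∀

  ≈-*ˡ : ∀ c {a b} → a ≈[ M ] b → c * a ≈[ M ] c * b
  ≈-*ˡ c = ≈-* (≈-refl {c})

  ≈-+-cancelʳ : ∀ {a b} c → a + c ≈[ M ] b + c → a ≈[ M ] b
  ≈-+-cancelʳ {a} {b} c (k , l , e) =
    k , l , +-cancelʳ-≡ c _ _ (trans (sym (move a c k M)) (trans e (move b c l M)))
    where
    move : ∀ a c k M → a + c + k * M ≡ a + k * M + c
    move = solve-∀

  k*M≈0 : ∀ k → k * M ≈[ M ] 0
  k*M≈0 k = 0 , k , +-identityʳ (k * M)

  ∣⇒≈0 : ∀ {a} → M ∣ a → a ≈[ M ] 0
  ∣⇒≈0 (divides q refl) = k*M≈0 q

  ≈0⇒∣ : ∀ {a} → a ≈[ M ] 0 → M ∣ a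
  ≈0⇒∣ {a} (k , l , e) =
    ∣m+n∣m⇒∣n (subst (M ∣_) (trans (sym e) (+-comm a _)) (n∣m*n l)) (n∣m*n k)

  ≈⇒%≡ : ∀ {a b} .{{_ : NonZero M}} → a ≈[ M ] b → a % M ≡ b % M
  ≈⇒%≡ {a} {b} (k , l , e) =
    trans (sym ([m+kn]%n≡m%n a k M)) (trans (cong (_% M) e) ([m+kn]%n≡m%n b l M))

≈-setoid : ℕ → Setoid 0ℓ 0ℓ
≈-setoid M = record { isEquivalence = ≈-isEquivalence {M} }

≈-*-scale : ∀ {M a b} N → a ≈[ M ] b → a * N ≈[ M * N ] b * N
≈-*-scale {M} {a} {b} N (k , l , e) =
  k , l , trans (factor a k M N) (trans (cong (_* N) e) (sym (factor b l M N)))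
  where
  factor : ∀ a k M N → a * N + k * (M * N) ≡ (a + k * M) * N
  factor = solve-∀

a+[p∸1]*a≈0 : ∀ p .{{_ : NonZero p}} a → a + (p ∸ 1) * a ≈[ p ] 0
a+[p∸1]*a≈0 p a = ≈-trans (≈-reflexive (trans (a+q*a≡[1+q]*a a (p ∸ 1)) p*a≡a*p)) (k*M≈0 a)
  where
  a+q*a≡[1+q]*a : ∀ a q → a + q * a ≡ suc q * a
  a+q*a≡[1+q]*a = solve-∀
  p*a≡a*p : suc (p ∸ 1) * a ≡ a * p
  p*a≡a*p = trans (cong (_* a) (m+[n∸m]≡n (>-nonZero⁻¹ p))) (*-comm p a)

-- Binomial coefficients modulo p

pascal : ∀ n k → suc n C suc k ≡ n C k + n C suc k
pascal n k = sym (nCk+nC[k+1]≡[n+1]C[k+1] n k)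

0C[1+k]≡0 : ∀ k → 0 C suc k ≡ 0
0C[1+k]≡0 k = k>n⇒nCk≡0 {0} {suc k} z<s

[1+k]*[1+n]C[1+k]≡[1+n]*nCk : ∀ n k → suc k * (suc n C suc k) ≡ suc n * (n C k)
[1+k]*[1+n]C[1+k]≡[1+n]*nCk zero zero = refl
[1+k]*[1+n]C[1+k]≡[1+n]*nCk zero (suc k) =
  trans (cong (suc (suc k) *_) (k>n⇒nCk≡0 {1} {suc (suc k)} (s<s z<s))) (*-zeroʳ (suc (suc k)))
[1+k]*[1+n]C[1+k]≡[1+n]*nCk (suc n) zero =
  trans (+-identityʳ _) (trans (nC1≡n (suc (suc n))) (sym (*-identityʳ (suc (suc n)))))
[1+k]*[1+n]C[1+k]≡[1+n]*nCk (suc n) (suc k) = begin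
  suc (suc k) * (suc (suc n) C suc (suc k))
    ≡⟨ cong (suc (suc k) *_) (trans (pascal (suc n) (suc k)) (cong (_+ Z) (pascal n k))) ⟩
  suc (suc k) * (X + Y + Z)                   ≡⟨ distribute k X Y Z ⟩
  suc k * (X + Y) + (X + Y) + suc (suc k) * Z
    ≡⟨ cong₂ (λ u v → u + (X + Y) + v) ih₁ ih₂ ⟩
  suc n * X + (X + Y) + suc n * Y             ≡⟨ collect n X Y ⟩
  suc (suc n) * (X + Y)                       ≡⟨ cong (suc (suc n) *_) (pascal n k) ⟨
  suc (suc n) * (suc n C suc k)               ∎
  where
  open ≡-Reasoning
  X = n C k
  Y = n C suc k
  Z = suc n C suc (suc k)
  ih₁ : suc k * (X + Y) ≡ suc n * X
  ih₁ = trans (cong (suc k *_) (sym (pascal n k))) ([1+k]*[1+n]C[1+k]≡[1+n]*nCk n k)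
  ih₂ : suc (suc k) * Z ≡ suc n * Y
  ih₂ = [1+k]*[1+n]C[1+k]≡[1+n]*nCk n (suc k)
  distribute : ∀ k X Y Z → suc (suc k) * (X + Y + Z) ≡ suc k * (X + Y) + (X + Y) + suc (suc k) * Z
  distribute = solve-∀
  collect : ∀ n X Y → suc n * X + (X + Y) + suc n * Y ≡ suc (suc n) * (X + Y)
  collect = solve-∀

p^ℓ∣j*b⇒p∣b : ∀ {p} → Prime p → ∀ ℓ {j} b → 0 < j → j < p ^ ℓ → p ^ ℓ ∣ j * b → p ∣ b
p^ℓ∣j*b⇒p∣b pp zero {suc j} b _ (s≤s ()) _
p^ℓ∣j*b⇒p∣b {p} pp (suc ℓ) {j} b 0<j j<p^[1+ℓ] p^[1+ℓ]∣j*b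
  with euclidsLemma j b pp (∣-trans (m∣m*n (p ^ ℓ)) p^[1+ℓ]∣j*b)
... | inj₂ p∣b = p∣b
... | inj₁ (divides q refl) = p^ℓ∣j*b⇒p∣b pp ℓ b 0<q q<p^ℓ p^ℓ∣q*b
  where
  instance _ = prime⇒nonZero pp
  0<q : 0 < q
  0<q = >-nonZero⁻¹ q {{m*n≢0⇒m≢0 q {{>-nonZero 0<j}}}}
  q<p^ℓ : q < p ^ ℓ
  q<p^ℓ = *-cancelʳ-< p q (p ^ ℓ) (subst (q * p <_) (*-comm p (p ^ ℓ)) j<p^[1+ℓ])
  p^ℓ∣q*b : p ^ ℓ ∣ q * b
  p^ℓ∣q*b = *-cancelˡ-∣ p (subst (p * p ^ ℓ ∣_) (reassoc q p b) p^[1+ℓ]∣j*b)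
    where
    reassoc : ∀ q p b → q * p * b ≡ p * (q * b)
    reassoc = solve-∀

-- (1 + X)^m ≡ 1 + X^m over 𝔽_p
InnerBinomialsDivisible : ℕ → ℕ → Set
InnerBinomialsDivisible p m = ∀ {j} → 0 < j → j < m → p ∣ m C j

prime-power-innerBinomialsDivisible : ∀ {p} → Prime p → ∀ ℓ → InnerBinomialsDivisible p (p ^ ℓ)
prime-power-innerBinomialsDivisible {p} pp ℓ {j} 0<j j<p^ℓ =
  p^ℓ∣j*b⇒p∣b pp ℓ (p ^ ℓ C j) 0<j j<p^ℓ (m∣j*mCj (p ^ ℓ) 0<j)
  where
  m∣j*mCj : ∀ m {j} → 0 < j → m ∣ j * (m C j)
  m∣j*mCj zero {suc k} _ = subst (0 ∣_) (sym (trans (cong (suc k *_) (0C[1+k]≡0 k)) (*-zeroʳ (suc k)))) (0 ∣0)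
  m∣j*mCj (suc n) {suc k} _ =
    divides (n C k) (trans ([1+k]*[1+n]C[1+k]≡[1+n]*nCk n k) (*-comm (suc n) (n C k)))

module ≈-Reasoning (M : ℕ) = Relation.Binary.Reasoning.Setoid (≈-setoid M)

C-shift : ∀ {p m} → InnerBinomialsDivisible p m → ∀ N {j} → j < m → (N + m) C j ≈[ p ] N C j
C-shift inner zero    {zero}  _   = ≈-refl
C-shift inner zero    {suc k} j<m = ≈-trans (∣⇒≈0 (inner z<s j<m)) (≈-reflexive (sym (0C[1+k]≡0 k)))
C-shift inner (suc N) {zero}  _   = ≈-refl
C-shift {p} {m} inner (suc N) {suc k} j<m = begin
  (suc N + m) C suc k                   ≡⟨ pascal (N + m) k ⟩
  (N + m) C k + (N + m) C suc k         ≈⟨ ≈-+ (C-shift inner N (<-trans (n<1+n k) j<m)) (C-shift inner N j<m) ⟩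
  N C k + N C suc k                     ≡⟨ pascal N k ⟨
  suc N C suc k                         ∎
  where open ≈-Reasoning p

C-periodic : ∀ {p m} → InnerBinomialsDivisible p m → ∀ q N {j} → j < m → (N + q * m) C j ≈[ p ] N C j
C-periodic {p} {m} inner zero N {j} _ = ≈-reflexive (cong (_C j) (+-identityʳ N))
C-periodic {p} {m} inner (suc q) N {j} j<m = begin
  (N + (m + q * m)) C j   ≡⟨ cong (_C j) (reassoc N m (q * m)) ⟩
  (N + q * m + m) C j     ≈⟨ C-shift inner (N + q * m) j<m ⟩
  (N + q * m) C j         ≈⟨ C-periodic inner q N j<m ⟩
  N C j                   ∎
  where
  open ≈-Reasoning p
  reassoc : ∀ a b c → a + (b + c) ≡ a + c + b
  reassoc = solve-∀

C-shift-diagonal : ∀ {p m} → InnerBinomialsDivisible p m → 0 < m → ∀ N → (N + m) C m ≈[ p ] N C m + 1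
C-shift-diagonal {m = suc m′} inner _ zero =
  ≈-reflexive (trans (nCn≡1 (suc m′)) (cong (_+ 1) (sym (0C[1+k]≡0 m′))))
C-shift-diagonal {p} {suc m′} inner 0<m (suc N) = begin
  (suc N + m) C suc m′              ≡⟨ pascal (N + m) m′ ⟩
  (N + m) C m′ + (N + m) C m        ≈⟨ ≈-+ (C-shift inner N ≤-refl) (C-shift-diagonal inner 0<m N) ⟩
  N C m′ + (N C m + 1)              ≡⟨ +-assoc (N C m′) (N C m) 1 ⟨
  N C m′ + N C m + 1                ≡⟨ cong (_+ 1) (pascal N m′) ⟨
  suc N C m + 1                     ∎
  where
  open ≈-Reasoning p
  m = suc m′

C-digit : ∀ {p m} → InnerBinomialsDivisible p m → 0 < m → ∀ α {r} → r < m → (r + α * m) C m ≈[ p ] α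
C-digit {p} {m} inner 0<m zero {r} r<m =
  ≈-reflexive (trans (cong (_C m) (+-identityʳ r)) (k>n⇒nCk≡0 r<m))
C-digit {p} {m} inner 0<m (suc α) {r} r<m = begin
  (r + (m + α * m)) C m     ≡⟨ cong (_C m) (reassoc r m (α * m)) ⟩
  (r + α * m + m) C m       ≈⟨ C-shift-diagonal inner 0<m (r + α * m) ⟩
  (r + α * m) C m + 1       ≈⟨ ≈-+ (C-digit inner 0<m α r<m) ≈-refl ⟩
  α + 1                     ≡⟨ +-comm α 1 ⟩
  suc α                     ∎
  where
  open ≈-Reasoning p
  reassoc : ∀ a b c → a + (b + c) ≡ a + c + b
  reassoc = solve-∀

≈-from-binomial-digits : ∀ {p} → Prime p → ∀ ℓ {t i} →
  (∀ {k} → k < ℓ → t C p ^ k ≈[ p ] i C p ^ k) → t ≈[ p ^ ℓ ] i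
≈-from-binomial-digits pp zero {t} {i} _ = i , t , swap t i
  where
  swap : ∀ t i → t + i * 1 ≡ i + t * 1
  swap = solve-∀
≈-from-binomial-digits {p} pp (suc ℓ) {t} {i} same =
  ≈-trans (≈-reflexive (m≡m%n+[m/n]*n t m))
    (≈-trans (≈-+ ≈-refl (≈-*-scale m quotients)) (≈-reflexive (sym i-split)))
  where
  m = p ^ ℓ
  instance _ = m^n≢0 p ℓ {{prime⇒nonZero pp}}
  0<m : 0 < m
  0<m = >-nonZero⁻¹ m
  inner = prime-power-innerBinomialsDivisible pp ℓ
  i-split : i ≡ t % m + (i / m) * m
  i-split = trans (m≡m%n+[m/n]*n i m)
    (cong (_+ (i / m) * m) (sym (≈⇒%≡ (≈-from-binomial-digits pp ℓ (λ k<ℓ → same (m<n⇒m<1+n k<ℓ))))))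
  quotients : t / m ≈[ p ] i / m
  quotients = begin
    t / m                        ≈⟨ C-digit inner 0<m (t / m) (m%n<n t m) ⟨
    (t % m + (t / m) * m) C m    ≡⟨ cong (_C m) (m≡m%n+[m/n]*n t m) ⟨
    t C m                        ≈⟨ same ≤-refl ⟩
    i C m                        ≡⟨ cong (_C m) i-split ⟩
    (t % m + (i / m) * m) C m    ≈⟨ C-digit inner 0<m (i / m) (m%n<n t m) ⟩
    i / m                        ∎
    where open ≈-Reasoning p

∑ : {A : Set} → List A → (A → ℕ) → ℕ
∑ xs g = sum (map g xs)

module _ {A : Set} where

  ∑-++ : ∀ (xs ys : List A) g → ∑ (xs ++ ys) g ≡ ∑ xs g + ∑ ys g
  ∑-++ xs ys g = trans (cong sum (map-++ g xs ys)) (sum-++ (map g xs) (map g ys))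

  ∑-map : ∀ {B : Set} (f : B → A) xs g → ∑ (map f xs) g ≡ ∑ xs (g ∘ f)
  ∑-map f xs g = cong sum (sym (map-∘ xs))

  ∑-cong : ∀ (xs : List A) {g h} → (∀ x → g x ≡ h x) → ∑ xs g ≡ ∑ xs h
  ∑-cong xs g≗h = cong sum (map-cong g≗h xs)

  ∑-zero : ∀ {xs : List A} {g} → All (λ x → g x ≡ 0) xs → ∑ xs g ≡ 0
  ∑-zero []           = refl
  ∑-zero (gx≡0 ∷ gs≡0) = cong₂ _+_ gx≡0 (∑-zero gs≡0)

  ∑-+ : ∀ (xs : List A) g h → ∑ xs (λ x → g x + h x) ≡ ∑ xs g + ∑ xs h
  ∑-+ []       g h = refl
  ∑-+ (x ∷ xs) g h = trans (cong (g x + h x +_) (∑-+ xs g h)) (interchange (g x) (h x) _ _)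
    where
    interchange : ∀ a b c d → a + b + (c + d) ≡ a + c + (b + d)
    interchange = solve-∀

  ∑-*ˡ : ∀ (xs : List A) c g → ∑ xs (λ x → c * g x) ≡ c * ∑ xs g
  ∑-*ˡ []       c g = sym (*-zeroʳ c)
  ∑-*ˡ (x ∷ xs) c g = trans (cong (c * g x +_) (∑-*ˡ xs c g)) (sym (*-distribˡ-+ c (g x) _))

  ∑-≈ : ∀ {M} {xs : List A} {g h} → All (λ x → g x ≈[ M ] h x) xs → ∑ xs g ≈[ M ] ∑ xs h
  ∑-≈ []         = ≈-refl
  ∑-≈ (gx≈hx ∷ gs≈hs) = ≈-+ gx≈hx (∑-≈ gs≈hs)

∑-comm : ∀ {A B : Set} (xs : List A) (ys : List B) (g : A → B → ℕ) →
  ∑ xs (λ x → ∑ ys (g x)) ≡ ∑ ys (λ y → ∑ xs (λ x → g x y))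
∑-comm []       ys g = sym (∑-zero (All.universal (λ _ → refl) ys))
∑-comm (x ∷ xs) ys g = trans (cong (∑ ys (g x) +_) (∑-comm xs ys g)) (sym (∑-+ ys (g x) _))

-- Polynomials on the Boolean cube

bits : ∀ {n} → Vec Bool n → Vec ℕ n
bits = V.map bit

complement : ∀ {n} → Vec Bool n → Vec Bool n
complement = V.map not

weight-≤ : ∀ {n} (x : Vec Bool n) → weight x ≤ n
weight-≤ []          = z≤n
weight-≤ (true ∷ x)  = s≤s (weight-≤ x)
weight-≤ (false ∷ x) = m≤n⇒m≤1+n (weight-≤ x)

weight-complement : ∀ {n} (x : Vec Bool n) → weight (complement x) + weight x ≡ n
weight-complement []          = refl
weight-complement (true ∷ x)  = trans (+-suc (weight (complement x)) _) (cong suc (weight-complement x))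
weight-complement (false ∷ x) = cong suc (weight-complement x)

weight-complement-∸ : ∀ {n} (x : Vec Bool n) → weight (complement x) ≡ n ∸ weight x
weight-complement-∸ x =
  trans (sym (m+n∸n≡m (weight (complement x)) (weight x))) (cong (_∸ weight x) (weight-complement x))

complement-involutive : ∀ {n} (x : Vec Bool n) → complement (complement x) ≡ x
complement-involutive []          = refl
complement-involutive (true ∷ x)  = cong (true ∷_) (complement-involutive x)
complement-involutive (false ∷ x) = cong (false ∷_) (complement-involutive x)

vectorOfWeight : ∀ n {t} → t ≤ n → Σ (Vec Bool n) (λ y → weight y ≡ t)
vectorOfWeight zero    z≤n = [] , refl
vectorOfWeight (suc n) {zero} _ with vectorOfWeight n z≤n
... | y , w = false ∷ y , w
vectorOfWeight (suc n) {suc t} (s≤s t≤n) with vectorOfWeight n t≤n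
... | y , w = true ∷ y , cong suc w

subsetsOfSize : ∀ {n} → Vec Bool n → ℕ → List (Vec Bool n)
subsetsOfSize []          zero    = [] ∷ []
subsetsOfSize []          (suc k) = []
subsetsOfSize (false ∷ y) k       = map (false ∷_) (subsetsOfSize y k)
subsetsOfSize (true ∷ y)  zero    = map (false ∷_) (subsetsOfSize y zero)
subsetsOfSize (true ∷ y)  (suc k) = map (false ∷_) (subsetsOfSize y (suc k)) ++ map (true ∷_) (subsetsOfSize y k)

subsetsOfSize-weight : ∀ {n} (y : Vec Bool n) k → All (λ x → weight x ≡ k) (subsetsOfSize y k)
subsetsOfSize-weight []          zero    = refl ∷ []
subsetsOfSize-weight []          (suc k) = []
subsetsOfSize-weight (false ∷ y) k       = AllP.map⁺ (subsetsOfSize-weight y k)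
subsetsOfSize-weight (true ∷ y)  zero    = AllP.map⁺ (subsetsOfSize-weight y zero)
subsetsOfSize-weight (true ∷ y)  (suc k) =
  AllP.++⁺ (AllP.map⁺ (subsetsOfSize-weight y (suc k))) (AllP.map⁺ (All.map (cong suc) (subsetsOfSize-weight y k)))

_⊑_ : ∀ {n} → Vec ℕ n → Vec Bool n → Bool
[]          ⊑ []      = true
(zero ∷ e)  ⊑ (_ ∷ x) = e ⊑ x
(suc _ ∷ e) ⊑ (b ∷ x) = b ∧ e ⊑ x

supportSize : ∀ {n} → Vec ℕ n → ℕ
supportSize []          = 0
supportSize (zero ∷ e)  = supportSize e
supportSize (suc _ ∷ e) = suc (supportSize e)

supportSize-≤ : ∀ {n} (e : Vec ℕ n) → supportSize e ≤ monoDeg e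
supportSize-≤ []          = z≤n
supportSize-≤ (zero ∷ e)  = supportSize-≤ e
supportSize-≤ (suc k ∷ e) = s≤s (≤-trans (supportSize-≤ e) (m≤n+m _ k))

supportSize-bits : ∀ {n} (x : Vec Bool n) → supportSize (bits x) ≡ weight x
supportSize-bits []          = refl
supportSize-bits (true ∷ x)  = cong suc (supportSize-bits x)
supportSize-bits (false ∷ x) = supportSize-bits x

monoDeg-bits : ∀ {n} (x : Vec Bool n) → monoDeg (bits x) ≡ weight x
monoDeg-bits []          = refl
monoDeg-bits (true ∷ x)  = cong suc (monoDeg-bits x)
monoDeg-bits (false ∷ x) = monoDeg-bits x

⊑⇒supportSize≤weight : ∀ {n} (e : Vec ℕ n) x → e ⊑ x ≡ true → supportSize e ≤ weight x
⊑⇒supportSize≤weight []          []          _ = z≤n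
⊑⇒supportSize≤weight (zero ∷ e)  (b ∷ x)     h = ≤-trans (⊑⇒supportSize≤weight e x h) (m≤n+m _ _)
⊑⇒supportSize≤weight (suc _ ∷ e) (true ∷ x)  h = s≤s (⊑⇒supportSize≤weight e x h)

bits-⊑-refl : ∀ {n} (x : Vec Bool n) → bits x ⊑ x ≡ true
bits-⊑-refl []          = refl
bits-⊑-refl (true ∷ x)  = bits-⊑-refl x
bits-⊑-refl (false ∷ x) = bits-⊑-refl x

excess : ∀ {n} → Vec Bool n → Vec Bool n → ℕ
excess []          []      = 0
excess (true ∷ y)  (_ ∷ x) = excess y x
excess (false ∷ y) (b ∷ x) = bit b + excess y x

excess-self : ∀ {n} (y : Vec Bool n) → excess y y ≡ 0
excess-self []          = refl
excess-self (true ∷ y)  = excess-self y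
excess-self (false ∷ y) = excess-self y

weight-excess : ∀ {n} (y x : Vec Bool n) → bits y ⊑ x ≡ true → weight x ≡ weight y + excess y x
weight-excess []          []          _ = refl
weight-excess (true ∷ y)  (true ∷ x)  h = cong suc (weight-excess y x h)
weight-excess (false ∷ y) (true ∷ x)  h = trans (cong suc (weight-excess y x h)) (sym (+-suc (weight y) _))
weight-excess (false ∷ y) (false ∷ x) h = weight-excess y x h

subvectorOfWeight : ∀ {n} → Vec Bool n → ℕ → Vec Bool n
subvectorOfWeight []          k       = []
subvectorOfWeight (_ ∷ y)     zero    = false ∷ subvectorOfWeight y zero
subvectorOfWeight (false ∷ y) (suc k) = false ∷ subvectorOfWeight y (suc k)
subvectorOfWeight (true ∷ y)  (suc k) = true ∷ subvectorOfWeight y k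

subvectorOfWeight-weight : ∀ {n} (y : Vec Bool n) {k} → k ≤ weight y → weight (subvectorOfWeight y k) ≡ k
subvectorOfWeight-weight []          {zero}  _         = refl
subvectorOfWeight-weight (_ ∷ y)     {zero}  _         = subvectorOfWeight-weight y z≤n
subvectorOfWeight-weight (false ∷ y) {suc k} k≤w       = subvectorOfWeight-weight y k≤w
subvectorOfWeight-weight (true ∷ y)  {suc k} (s≤s k≤w) = cong suc (subvectorOfWeight-weight y k≤w)

subvectorOfWeight-⊑ : ∀ {n} (y : Vec Bool n) k → bits (subvectorOfWeight y k) ⊑ y ≡ true
subvectorOfWeight-⊑ []          k       = refl
subvectorOfWeight-⊑ (_ ∷ y)     zero    = subvectorOfWeight-⊑ y zero
subvectorOfWeight-⊑ (false ∷ y) (suc k) = subvectorOfWeight-⊑ y (suc k)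
subvectorOfWeight-⊑ (true ∷ y)  (suc k) = subvectorOfWeight-⊑ y k

evalMono-bits : ∀ {n} (e : Vec ℕ n) x → evalMono e (bits x) ≡ bit (e ⊑ x)
evalMono-bits []          []          = refl
evalMono-bits (zero ∷ e)  (b ∷ x)     = trans (*-identityˡ _) (evalMono-bits e x)
evalMono-bits (suc k ∷ e) (true ∷ x)  =
  trans (cong (_* evalMono e (bits x)) (^-zeroˡ (suc k))) (trans (*-identityˡ _) (evalMono-bits e x))
evalMono-bits (suc k ∷ e) (false ∷ x) = refl

evalPoly-bits : ∀ {n} (f : Poly n) x → evalPoly f (bits x) ≡ ∑ f (λ t → proj₁ t * bit (proj₂ t ⊑ x))
evalPoly-bits f x = ∑-cong f (λ t → cong (proj₁ t *_) (evalMono-bits (proj₂ t) x))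

evalPoly-++ : ∀ {n} (f g : Poly n) a → evalPoly (f ++ g) a ≡ evalPoly f a + evalPoly g a
evalPoly-++ f g a = ∑-++ f g _

DegLe-++ : ∀ {n} {f g : Poly n} {d} → DegLe f d → DegLe g d → DegLe (f ++ g) d
DegLe-++ = AllP.++⁺

DegLe-weaken : ∀ {n} {f : Poly n} {d d′} → d ≤ d′ → DegLe f d → DegLe f d′
DegLe-weaken d≤d′ = All.map (λ deg≤d → ≤-trans deg≤d d≤d′)

X₀^_·_ : ∀ {n} → ℕ → Poly n → Poly (suc n)
X₀^ k · f = map (λ t → proj₁ t , k ∷ proj₂ t) f

evalPoly-X₀^· : ∀ {n} k (f : Poly n) a₀ a → evalPoly (X₀^ k · f) (a₀ ∷ a) ≡ a₀ ^ k * evalPoly f a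
evalPoly-X₀^· k f a₀ a = begin
  ∑ (X₀^ k · f) _                                  ≡⟨ ∑-map _ f _ ⟩
  ∑ f (λ t → proj₁ t * (a₀ ^ k * evalMono (proj₂ t) a)) ≡⟨ ∑-cong f (λ t → x*[y*z]≡y*[x*z] (proj₁ t) (a₀ ^ k) _) ⟩
  ∑ f (λ t → a₀ ^ k * (proj₁ t * evalMono (proj₂ t) a)) ≡⟨ ∑-*ˡ f (a₀ ^ k) _ ⟩
  a₀ ^ k * evalPoly f a                            ∎
  where
  open ≡-Reasoning
  x*[y*z]≡y*[x*z] : ∀ x y z → x * (y * z) ≡ y * (x * z)
  x*[y*z]≡y*[x*z] = solve-∀

DegLe-X₀^· : ∀ {n} k {f : Poly n} {d} → DegLe f d → DegLe (X₀^ k · f) (k + d)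
DegLe-X₀^· k = AllP.map⁺ ∘ All.map (+-monoʳ-≤ k)

infixr 7 _*ᶜ_
_*ᶜ_ : ∀ {n} → ℕ → Poly n → Poly n
c *ᶜ f = map (λ t → c * proj₁ t , proj₂ t) f

evalPoly-*ᶜ : ∀ {n} c (f : Poly n) a → evalPoly (c *ᶜ f) a ≡ c * evalPoly f a
evalPoly-*ᶜ c f a =
  trans (∑-map _ f _) (trans (∑-cong f (λ t → *-assoc c (proj₁ t) _)) (∑-*ˡ f c _))

DegLe-*ᶜ : ∀ {n} c {f : Poly n} {d} → DegLe f d → DegLe (c *ᶜ f) d
DegLe-*ᶜ c = AllP.map⁺

restrict : ∀ {n} → Bool → Poly (suc n) → Poly n
restrict b f = map (λ { (c , e ∷ es) → c * bit b ^ e , es }) f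

evalPoly-restrict : ∀ {n} b (f : Poly (suc n)) a → evalPoly (restrict b f) a ≡ evalPoly f (bit b ∷ a)
evalPoly-restrict b []                 a = refl
evalPoly-restrict b ((c , e ∷ es) ∷ f) a = cong₂ _+_ (*-assoc c _ _) (evalPoly-restrict b f a)

DegLe-restrict : ∀ {n} b {f : Poly (suc n)} {d} → DegLe f d → DegLe (restrict b f) d
DegLe-restrict b {[]}                []           = []
DegLe-restrict b {(c , e ∷ es) ∷ f} (deg≤d ∷ ds) = ≤-trans (m≤n+m (V.sum es) e) deg≤d ∷ DegLe-restrict b ds

constant : ∀ {n} → ℕ → Poly n
constant {n} c = (c , V.replicate n 0) ∷ []

evalPoly-constant : ∀ {n} c (x : Vec Bool n) → evalPoly (constant c) (bits x) ≡ c
evalPoly-constant {n} c x = begin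
  c * evalMono (V.replicate n 0) (bits x) + 0  ≡⟨ +-identityʳ _ ⟩
  c * evalMono (V.replicate n 0) (bits x)      ≡⟨ cong (c *_) (evalMono-bits (V.replicate n 0) x) ⟩
  c * bit (V.replicate n 0 ⊑ x)                ≡⟨ cong (λ b → c * bit b) (zero⊑ x) ⟩
  c * 1                                        ≡⟨ *-identityʳ c ⟩
  c                                            ∎
  where
  open ≡-Reasoning
  zero⊑ : ∀ {n} (x : Vec Bool n) → V.replicate n 0 ⊑ x ≡ true
  zero⊑ []      = refl
  zero⊑ (_ ∷ x) = zero⊑ x

DegLe-constant : ∀ {n} c {d} → DegLe (constant {n} c) d
DegLe-constant {n} c = ≤-trans (≤-reflexive (sum-zeros n)) z≤n ∷ []
  where
  sum-zeros : ∀ n → V.sum (V.replicate n 0) ≡ 0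
  sum-zeros zero    = refl
  sum-zeros (suc n) = sum-zeros n

monomial : ∀ {n} → Vec Bool n → Poly n
monomial A = (1 , bits A) ∷ []

evalPoly-monomial : ∀ {n} (A x : Vec Bool n) → evalPoly (monomial A) (bits x) ≡ bit (bits A ⊑ x)
evalPoly-monomial A x = trans (+-identityʳ _) (trans (*-identityˡ _) (evalMono-bits (bits A) x))

DegLe-monomial : ∀ {n} (A : Vec Bool n) → DegLe (monomial A) (weight A)
DegLe-monomial A = ≤-reflexive (monoDeg-bits A) ∷ []

evalPoly-X₀^0· : ∀ {n} (f : Poly n) a₀ a → evalPoly (X₀^ 0 · f) (a₀ ∷ a) ≡ evalPoly f a
evalPoly-X₀^0· f a₀ a = trans (evalPoly-X₀^· 0 f a₀ a) (*-identityˡ _)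

evalPoly-X₀^1· : ∀ {n} (f : Poly n) a₀ a → evalPoly (X₀^ 1 · f) (a₀ ∷ a) ≡ a₀ * evalPoly f a
evalPoly-X₀^1· f a₀ a = trans (evalPoly-X₀^· 1 f a₀ a) (cong (_* evalPoly f a) (*-identityʳ a₀))

elementary : ∀ n → ℕ → Poly n
elementary n k = map (λ A → 1 , bits A) (subsetsOfSize (V.replicate n true) k)

DegLe-elementary : ∀ n k → DegLe (elementary n k) k
DegLe-elementary n k =
  AllP.map⁺ (All.map (λ {A} wA≡k → ≤-reflexive (trans (monoDeg-bits A) wA≡k))
                     (subsetsOfSize-weight (V.replicate n true) k))

countSubsetsOf : ∀ {n} k (x : Vec Bool n) →
  ∑ (subsetsOfSize (V.replicate n true) k) (λ A → bit (bits A ⊑ x)) ≡ weight x C k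
countSubsetsOf zero    []      = refl
countSubsetsOf (suc k) []      = sym (0C[1+k]≡0 k)
countSubsetsOf {suc n} zero (b ∷ x) =
  trans (∑-map (false ∷_) (subsetsOfSize (V.replicate n true) zero) _) (countSubsetsOf zero x)
countSubsetsOf {suc n} (suc k) (b ∷ x) = begin
  ∑ (map (false ∷_) (Sub (suc k)) ++ map (true ∷_) (Sub k)) count
    ≡⟨ ∑-++ (map (false ∷_) (Sub (suc k))) _ count ⟩
  ∑ (map (false ∷_) (Sub (suc k))) count + ∑ (map (true ∷_) (Sub k)) count
    ≡⟨ cong₂ _+_ (trans (∑-map (false ∷_) (Sub (suc k)) count) (countSubsetsOf (suc k) x))
                 (∑-map (true ∷_) (Sub k) count) ⟩
  weight x C suc k + ∑ (Sub k) (λ A → bit (b ∧ bits A ⊑ x))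
    ≡⟨ add b ⟩
  weight (b ∷ x) C suc k ∎
  where
  open ≡-Reasoning
  Sub = subsetsOfSize (V.replicate n true)
  count : Vec Bool (suc n) → ℕ
  count A = bit (bits A ⊑ (b ∷ x))
  add : ∀ b → weight x C suc k + ∑ (Sub k) (λ A → bit (b ∧ bits A ⊑ x)) ≡ weight (b ∷ x) C suc k
  add true  = trans (cong (weight x C suc k +_) (countSubsetsOf k x))
                    (trans (+-comm (weight x C suc k) _) (sym (pascal (weight x) k)))
  add false = trans (cong (weight x C suc k +_) (∑-zero (All.universal (λ _ → refl) (Sub k)))) (+-identityʳ _)

evalPoly-elementary : ∀ n k (x : Vec Bool n) → evalPoly (elementary n k) (bits x) ≡ weight x C k
evalPoly-elementary n k x = begin
  evalPoly (elementary n k) (bits x)                     ≡⟨ evalPoly-bits (elementary n k) x ⟩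
  ∑ (elementary n k) (λ t → proj₁ t * bit (proj₂ t ⊑ x)) ≡⟨ ∑-map _ (subsetsOfSize (V.replicate n true) k) _ ⟩
  ∑ (subsetsOfSize (V.replicate n true) k) (λ A → 1 * bit (bits A ⊑ x))
    ≡⟨ ∑-cong (subsetsOfSize (V.replicate n true) k) (λ A → *-identityˡ _) ⟩
  ∑ (subsetsOfSize (V.replicate n true) k) (λ A → bit (bits A ⊑ x)) ≡⟨ countSubsetsOf k x ⟩
  weight x C k                                           ∎
  where open ≡-Reasoning

module _ (p : ℕ) .{{_ : NonZero p}} where

  private
    1+[p∸1]≡p : suc (p ∸ 1) ≡ p
    1+[p∸1]≡p = m+[n∸m]≡n (>-nonZero⁻¹ p)

  _+[p∸1]X₀·_ : ∀ {n} → Poly n → Poly n → Poly (suc n)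
  f +[p∸1]X₀· g = X₀^ 0 · f ++ (p ∸ 1) *ᶜ X₀^ 1 · g

  evalPoly-+[p∸1]X₀· : ∀ {n} (f g : Poly n) a₀ a →
    evalPoly (f +[p∸1]X₀· g) (a₀ ∷ a) ≡ evalPoly f a + (p ∸ 1) * (a₀ * evalPoly g a)
  evalPoly-+[p∸1]X₀· f g a₀ a =
    trans (evalPoly-++ (X₀^ 0 · f) _ (a₀ ∷ a))
      (cong₂ _+_ (evalPoly-X₀^0· f a₀ a)
                 (trans (evalPoly-*ᶜ (p ∸ 1) (X₀^ 1 · g) (a₀ ∷ a)) (cong ((p ∸ 1) *_) (evalPoly-X₀^1· g a₀ a))))

  DegLe-+[p∸1]X₀· : ∀ {n} {f g : Poly n} {d} → DegLe f (suc d) → DegLe g d → DegLe (f +[p∸1]X₀· g) (suc d)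
  DegLe-+[p∸1]X₀· deg-f deg-g = DegLe-++ (DegLe-X₀^· 0 deg-f) (DegLe-*ᶜ (p ∸ 1) (DegLe-X₀^· 1 deg-g))

  -- ∏_{j ∈ supp e} (1 + (p − 1) X_j), which agrees with X^e ∘ complement on the cube modulo p
  reflectMonomial : ∀ {n} → Vec ℕ n → Poly n
  reflectMonomial []          = constant 1
  reflectMonomial (zero ∷ e)  = X₀^ 0 · reflectMonomial e
  reflectMonomial (suc _ ∷ e) = reflectMonomial e +[p∸1]X₀· reflectMonomial e

  reflect : ∀ {n} → Poly n → Poly n
  reflect []            = []
  reflect ((c , e) ∷ f) = c *ᶜ reflectMonomial e ++ reflect f

  evalPoly-reflectMonomial : ∀ {n} (e : Vec ℕ n) x →
    evalPoly (reflectMonomial e) (bits x) ≈[ p ] bit (e ⊑ complement x)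
  evalPoly-reflectMonomial []          []      = ≈-refl
  evalPoly-reflectMonomial (zero ∷ e)  (b ∷ x) =
    ≈-trans (≈-reflexive (evalPoly-X₀^0· (reflectMonomial e) (bit b) (bits x))) (evalPoly-reflectMonomial e x)
  evalPoly-reflectMonomial (suc _ ∷ e) (b ∷ x) =
    ≈-trans (≈-reflexive (evalPoly-+[p∸1]X₀· (reflectMonomial e) (reflectMonomial e) (bit b) (bits x))) (flip b)
    where
    E = evalPoly (reflectMonomial e) (bits x)
    flip : ∀ b → E + (p ∸ 1) * (bit b * E) ≈[ p ] bit (not b ∧ e ⊑ complement x)
    flip false = ≈-trans (≈-reflexive (trans (cong (λ u → E + u) (*-zeroʳ (p ∸ 1))) (+-identityʳ E)))
                         (evalPoly-reflectMonomial e x)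
    flip true  = subst (λ u → E + (p ∸ 1) * u ≈[ p ] 0) (sym (*-identityˡ E)) (a+[p∸1]*a≈0 p E)

  evalPoly-reflect : ∀ {n} (f : Poly n) x → evalPoly (reflect f) (bits x) ≈[ p ] evalPoly f (bits (complement x))
  evalPoly-reflect []            x = ≈-refl
  evalPoly-reflect ((c , e) ∷ f) x = begin
    evalPoly (c *ᶜ reflectMonomial e ++ reflect f) (bits x)
      ≡⟨ evalPoly-++ (c *ᶜ reflectMonomial e) (reflect f) (bits x) ⟩
    evalPoly (c *ᶜ reflectMonomial e) (bits x) + evalPoly (reflect f) (bits x)
      ≡⟨ cong (_+ _) (evalPoly-*ᶜ c (reflectMonomial e) (bits x)) ⟩
    c * evalPoly (reflectMonomial e) (bits x) + evalPoly (reflect f) (bits x)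
      ≈⟨ ≈-+ (≈-*ˡ c (evalPoly-reflectMonomial e x)) (evalPoly-reflect f x) ⟩
    c * bit (e ⊑ complement x) + evalPoly f (bits (complement x))
      ≡⟨ cong (λ u → c * u + _) (evalMono-bits e (complement x)) ⟨
    evalPoly ((c , e) ∷ f) (bits (complement x)) ∎
    where open ≈-Reasoning p

  DegLe-reflectMonomial : ∀ {n} (e : Vec ℕ n) → DegLe (reflectMonomial e) (monoDeg e)
  DegLe-reflectMonomial []          = z≤n ∷ []
  DegLe-reflectMonomial (zero ∷ e)  = DegLe-X₀^· 0 (DegLe-reflectMonomial e)
  DegLe-reflectMonomial (suc k ∷ e) =
    DegLe-+[p∸1]X₀· (DegLe-weaken (m≤n+m _ (suc k)) (DegLe-reflectMonomial e))
                    (DegLe-weaken (m≤n+m _ k) (DegLe-reflectMonomial e))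

  DegLe-reflect : ∀ {n} {f : Poly n} {d} → DegLe f d → DegLe (reflect f) d
  DegLe-reflect {f = []}          []           = []
  DegLe-reflect {f = (c , e) ∷ f} (deg≤d ∷ ds) =
    DegLe-++ (DegLe-*ᶜ c (DegLe-weaken deg≤d (DegLe-reflectMonomial e))) (DegLe-reflect ds)

  -- ∏_{j ∈ y} X_j · ∑_{k ≤ s} (p − 1)^k e_k(X_j : j ∉ y); at x ⊇ y of excess e ≤ s it takes the value ∑_k C(e,k) (p − 1)^k = p^e
  aboveIndicator : ∀ {n} → Vec Bool n → ℕ → Poly n
  aboveIndicator []          s       = constant 1
  aboveIndicator (true ∷ y)  s       = X₀^ 1 · aboveIndicator y s
  aboveIndicator (false ∷ y) zero    = X₀^ 0 · aboveIndicator y zero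
  aboveIndicator (false ∷ y) (suc s) = aboveIndicator y (suc s) +[p∸1]X₀· aboveIndicator y s

  evalPoly-aboveIndicator-⋢ : ∀ {n} (y : Vec Bool n) s x → bits y ⊑ x ≡ false →
    evalPoly (aboveIndicator y s) (bits x) ≡ 0
  evalPoly-aboveIndicator-⋢ [] s [] ()
  evalPoly-aboveIndicator-⋢ (true ∷ y) s (b ∷ x) y⋢x =
    trans (evalPoly-X₀^1· (aboveIndicator y s) (bit b) (bits x)) (vanish b y⋢x)
    where
    vanish : ∀ b → (b ∧ bits y ⊑ x) ≡ false → bit b * evalPoly (aboveIndicator y s) (bits x) ≡ 0
    vanish true  y⋢x = trans (*-identityˡ _) (evalPoly-aboveIndicator-⋢ y s x y⋢x)
    vanish false _   = refl
  evalPoly-aboveIndicator-⋢ (false ∷ y) zero (b ∷ x) y⋢x =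
    trans (evalPoly-X₀^0· (aboveIndicator y zero) (bit b) (bits x)) (evalPoly-aboveIndicator-⋢ y zero x y⋢x)
  evalPoly-aboveIndicator-⋢ (false ∷ y) (suc s) (b ∷ x) y⋢x = begin
    evalPoly (aboveIndicator (false ∷ y) (suc s)) (bits (b ∷ x))
      ≡⟨ evalPoly-+[p∸1]X₀· (aboveIndicator y (suc s)) (aboveIndicator y s) (bit b) (bits x) ⟩
    evalPoly (aboveIndicator y (suc s)) (bits x) + (p ∸ 1) * (bit b * evalPoly (aboveIndicator y s) (bits x))
      ≡⟨ cong₂ (λ u v → u + (p ∸ 1) * (bit b * v)) (evalPoly-aboveIndicator-⋢ y (suc s) x y⋢x)
                                                    (evalPoly-aboveIndicator-⋢ y s x y⋢x) ⟩
    (p ∸ 1) * (bit b * 0)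
      ≡⟨ trans (cong ((p ∸ 1) *_) (*-zeroʳ (bit b))) (*-zeroʳ (p ∸ 1)) ⟩
    0 ∎
    where open ≡-Reasoning

  evalPoly-aboveIndicator-⊑ : ∀ {n} (y : Vec Bool n) s x → bits y ⊑ x ≡ true → excess y x ≤ s →
    evalPoly (aboveIndicator y s) (bits x) ≡ p ^ excess y x
  evalPoly-aboveIndicator-⊑ []          s       []         _   _ = evalPoly-constant 1 []
  evalPoly-aboveIndicator-⊑ (true ∷ y)  s       (true ∷ x) y⊑x e≤s =
    trans (evalPoly-X₀^1· (aboveIndicator y s) 1 (bits x))
          (trans (*-identityˡ _) (evalPoly-aboveIndicator-⊑ y s x y⊑x e≤s))
  evalPoly-aboveIndicator-⊑ (false ∷ y) zero    (false ∷ x) y⊑x e≤s =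
    trans (evalPoly-X₀^0· (aboveIndicator y zero) 0 (bits x)) (evalPoly-aboveIndicator-⊑ y zero x y⊑x e≤s)
  evalPoly-aboveIndicator-⊑ (false ∷ y) (suc s) (false ∷ x) y⊑x e≤s = begin
    evalPoly (aboveIndicator (false ∷ y) (suc s)) (bits (false ∷ x))
      ≡⟨ evalPoly-+[p∸1]X₀· (aboveIndicator y (suc s)) (aboveIndicator y s) 0 (bits x) ⟩
    evalPoly (aboveIndicator y (suc s)) (bits x) + (p ∸ 1) * 0
      ≡⟨ cong₂ (λ u v → u + v) (evalPoly-aboveIndicator-⊑ y (suc s) x y⊑x e≤s) (*-zeroʳ (p ∸ 1)) ⟩
    p ^ excess y x + 0
      ≡⟨ +-identityʳ _ ⟩
    p ^ excess y x ∎
    where open ≡-Reasoning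
  evalPoly-aboveIndicator-⊑ (false ∷ y) (suc s) (true ∷ x) y⊑x (s≤s e≤s) = begin
    evalPoly (aboveIndicator (false ∷ y) (suc s)) (bits (true ∷ x))
      ≡⟨ evalPoly-+[p∸1]X₀· (aboveIndicator y (suc s)) (aboveIndicator y s) 1 (bits x) ⟩
    evalPoly (aboveIndicator y (suc s)) (bits x) + (p ∸ 1) * (1 * evalPoly (aboveIndicator y s) (bits x))
      ≡⟨ cong₂ (λ u v → u + (p ∸ 1) * (1 * v)) (evalPoly-aboveIndicator-⊑ y (suc s) x y⊑x (m≤n⇒m≤1+n e≤s))
                                                (evalPoly-aboveIndicator-⊑ y s x y⊑x e≤s) ⟩
    p ^ e + (p ∸ 1) * (1 * p ^ e)
      ≡⟨ a+q*[1*a]≡[1+q]*a (p ^ e) (p ∸ 1) ⟩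
    suc (p ∸ 1) * p ^ e
      ≡⟨ cong (_* p ^ e) 1+[p∸1]≡p ⟩
    p ^ suc e ∎
    where
    open ≡-Reasoning
    e = excess y x
    a+q*[1*a]≡[1+q]*a : ∀ a q → a + q * (1 * a) ≡ suc q * a
    a+q*[1*a]≡[1+q]*a = solve-∀

  DegLe-aboveIndicator : ∀ {n} (y : Vec Bool n) s → DegLe (aboveIndicator y s) (weight y + s)
  DegLe-aboveIndicator []          s       = DegLe-constant 1
  DegLe-aboveIndicator (true ∷ y)  s       = DegLe-X₀^· 1 (DegLe-aboveIndicator y s)
  DegLe-aboveIndicator (false ∷ y) zero    = DegLe-X₀^· 0 (DegLe-aboveIndicator y zero)
  DegLe-aboveIndicator (false ∷ y) (suc s) =
    DegLe-weaken (≤-reflexive (sym (+-suc (weight y) s)))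
      (DegLe-+[p∸1]X₀· (DegLe-weaken (≤-reflexive (+-suc (weight y) s)) (DegLe-aboveIndicator y (suc s)))
                       (DegLe-aboveIndicator y s))

countContaining : ∀ {n} → Vec ℕ n → Vec Bool n → ℕ → ℕ
countContaining e y k = ∑ (subsetsOfSize y k) (λ x → bit (e ⊑ x))

∑-false∷-⊑ : ∀ {n} k (e : Vec ℕ n) (xs : List (Vec Bool n)) → ∑ (map (false ∷_) xs) (λ x → bit ((suc k ∷ e) ⊑ x)) ≡ 0
∑-false∷-⊑ k e xs = trans (∑-map (false ∷_) xs _) (∑-zero (All.universal (λ _ → refl) xs))

countContaining-< : ∀ {n} (e : Vec ℕ n) y k → k < supportSize e → countContaining e y k ≡ 0
countContaining-< e y k k<∣e∣ = ∑-zero (All.map absent (subsetsOfSize-weight y k))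
  where
  absent : ∀ {x} → weight x ≡ k → bit (e ⊑ x) ≡ 0
  absent {x} wx≡k with e ⊑ x in e⊑x
  ... | false = refl
  ... | true  = ⊥-elim (<⇒≱ k<∣e∣ (subst (supportSize e ≤_) wx≡k (⊑⇒supportSize≤weight e x e⊑x)))

countContaining-⋢ : ∀ {n} (e : Vec ℕ n) y k → e ⊑ y ≡ false → countContaining e y k ≡ 0
countContaining-⋢ []          []          k       ()
countContaining-⋢ (zero ∷ e)  (false ∷ y) k       e⋢y =
  trans (∑-map (false ∷_) (subsetsOfSize y k) _) (countContaining-⋢ e y k e⋢y)
countContaining-⋢ (zero ∷ e)  (true ∷ y)  zero    e⋢y =
  trans (∑-map (false ∷_) (subsetsOfSize y zero) _) (countContaining-⋢ e y zero e⋢y)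
countContaining-⋢ (zero ∷ e)  (true ∷ y)  (suc k) e⋢y =
  trans (∑-++ (map (false ∷_) (subsetsOfSize y (suc k))) _ _)
    (cong₂ _+_ (trans (∑-map (false ∷_) (subsetsOfSize y (suc k)) _) (countContaining-⋢ e y (suc k) e⋢y))
               (trans (∑-map (true ∷_) (subsetsOfSize y k) _) (countContaining-⋢ e y k e⋢y)))
countContaining-⋢ (suc j ∷ e) (false ∷ y) k       _   = ∑-false∷-⊑ j e (subsetsOfSize y k)
countContaining-⋢ (suc j ∷ e) (true ∷ y)  zero    _   = ∑-false∷-⊑ j e (subsetsOfSize y zero)
countContaining-⋢ (suc j ∷ e) (true ∷ y)  (suc k) e⋢y =
  trans (∑-++ (map (false ∷_) (subsetsOfSize y (suc k))) _ _)
    (cong₂ _+_ (∑-false∷-⊑ j e (subsetsOfSize y (suc k)))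
               (trans (∑-map (true ∷_) (subsetsOfSize y k) _) (countContaining-⋢ e y k e⋢y)))

countContaining-⊑ : ∀ {n} (e : Vec ℕ n) y {u j k} → e ⊑ y ≡ true →
  weight y ≡ supportSize e + u → k ≡ supportSize e + j → countContaining e y k ≡ u C j
countContaining-⊑ [] [] {j = zero}  _ refl refl = refl
countContaining-⊑ [] [] {j = suc j} _ refl refl = sym (0C[1+k]≡0 j)
countContaining-⊑ (zero ∷ e) (false ∷ y) {k = k} e⊑y wy kj =
  trans (∑-map (false ∷_) (subsetsOfSize y k) _) (countContaining-⊑ e y e⊑y wy kj)
countContaining-⊑ (zero ∷ e) (true ∷ y) {zero} e⊑y wy _ =
  ⊥-elim (<-irrefl refl (≤-trans (s≤s (⊑⇒supportSize≤weight e y e⊑y)) (≤-reflexive (trans wy (+-identityʳ _)))))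
countContaining-⊑ (zero ∷ e) (true ∷ y) {suc u} {zero} {zero} e⊑y wy kj =
  trans (∑-map (false ∷_) (subsetsOfSize y zero) _)
        (countContaining-⊑ e y e⊑y (suc-injective (trans wy (+-suc (supportSize e) u))) kj)
countContaining-⊑ (zero ∷ e) (true ∷ y) {suc u} {suc j} {zero} _ _ 0≡e+1+j =
  ⊥-elim (0≢1+n (trans 0≡e+1+j (+-suc (supportSize e) j)))
countContaining-⊑ (zero ∷ e) (true ∷ y) {suc u} {j} {suc k} e⊑y wy kj =
  trans (∑-++ (map (false ∷_) (subsetsOfSize y (suc k))) _ _)
    (trans (cong₂ _+_ (∑-map (false ∷_) (subsetsOfSize y (suc k)) _) (∑-map (true ∷_) (subsetsOfSize y k) _))
           (pascal-step j kj))
  where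
  wy′ : weight y ≡ supportSize e + u
  wy′ = suc-injective (trans wy (+-suc (supportSize e) u))
  pascal-step : ∀ j → suc k ≡ supportSize e + j → countContaining e y (suc k) + countContaining e y k ≡ suc u C j
  pascal-step zero    kj = cong₂ _+_ (countContaining-⊑ e y e⊑y wy′ kj)
                                     (countContaining-< e y k (≤-reflexive (trans kj (+-identityʳ _))))
  pascal-step (suc j) kj =
    trans (cong₂ _+_ (countContaining-⊑ e y e⊑y wy′ kj)
                     (countContaining-⊑ e y e⊑y wy′ (suc-injective (trans kj (+-suc (supportSize e) j)))))
          (trans (+-comm (u C suc j) (u C j)) (sym (pascal u j)))
countContaining-⊑ (suc _ ∷ e) (true ∷ y) {k = zero} e⊑y wy ()
countContaining-⊑ (suc i ∷ e) (true ∷ y) {k = suc k} e⊑y wy kj =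
  trans (∑-++ (map (false ∷_) (subsetsOfSize y (suc k))) _ _)
    (trans (cong₂ _+_ (∑-false∷-⊑ i e (subsetsOfSize y (suc k))) (∑-map (true ∷_) (subsetsOfSize y k) _))
           (countContaining-⊑ e y e⊑y (suc-injective wy) (suc-injective kj)))

-- Zariski closures of slices

Slice : ∀ {n} → ℕ → Vec Bool n → Set
Slice i x = weight x ≡ i

ZClW-extensive : ∀ {p n d} {E : ℕ → Set} {t} → t ≤ n → E t → ZClW p n d E t
ZClW-extensive {n = n} t≤n Et with vectorOfWeight n t≤n
... | y , refl = y , refl , λ f _ f-vanishes → f-vanishes y Et

ZCl-false∷ : ∀ {p n d s} {y : Vec Bool n} → ZCl p n d (Slice s) y → ZCl p (suc n) d (Slice s) (false ∷ y)
ZCl-false∷ {p} {y = y} y∈cl f deg-f f-vanishes =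
  subst (p ∣_) (evalPoly-restrict false f (bits y))
    (y∈cl (restrict false f) (DegLe-restrict false deg-f)
          (λ x wx → subst (p ∣_) (sym (evalPoly-restrict false f (bits x))) (f-vanishes (false ∷ x) wx)))

ZCl-true∷ : ∀ {p n d s} {y : Vec Bool n} → ZCl p n d (Slice s) y → ZCl p (suc n) d (Slice (suc s)) (true ∷ y)
ZCl-true∷ {p} {y = y} y∈cl f deg-f f-vanishes =
  subst (p ∣_) (evalPoly-restrict true f (bits y))
    (y∈cl (restrict true f) (DegLe-restrict true deg-f)
          (λ x wx → subst (p ∣_) (sym (evalPoly-restrict true f (bits x))) (f-vanishes (true ∷ x) (cong suc wx))))

module _ {p : ℕ} .{{_ : NonZero p}} where

  ZCl-complement : ∀ {n d i} {y : Vec Bool n} → ZCl p n d (Slice i) y → ZCl p n d (Slice (n ∸ i)) (complement y)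
  ZCl-complement {n} {d} {i} {y} y∈cl f deg-f f-vanishes = ≈0⇒∣ (begin
    evalPoly f (bits (complement y))  ≈⟨ evalPoly-reflect p (f) y ⟨
    evalPoly (reflect p f) (bits y)   ≈⟨ ∣⇒≈0 (y∈cl (reflect p f) (DegLe-reflect p deg-f) reflect-vanishes) ⟩
    0                                 ∎)
    where
    open ≈-Reasoning p
    reflect-vanishes : ∀ x → Slice i x → VanishesAt p (reflect p f) x
    reflect-vanishes x refl = ≈0⇒∣ (≈-trans (evalPoly-reflect p f x)
                                            (∣⇒≈0 (f-vanishes (complement x) (weight-complement-∸ x))))

module _ {p : ℕ} (pp : Prime p) where

  private instance _ = prime⇒nonZero pp

  p∤1 : ¬ p ∣ 1
  p∤1 p∣1 = ¬prime[1] (subst Prime (∣1⇒≡1 p∣1) pp)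

  ZCl-binomial : ∀ {n d i k} {y : Vec Bool n} → k ≤ d → ZCl p n d (Slice i) y → weight y C k ≈[ p ] i C k
  ZCl-binomial {n} {d} {i} {k} {y} k≤d y∈cl = ≈-+-cancelʳ c (begin
    weight y C k + c     ≡⟨ g-value y ⟨
    evalPoly g (bits y)  ≈⟨ ∣⇒≈0 (y∈cl g deg-g g-vanishes) ⟩
    0                    ≈⟨ a+[p∸1]*a≈0 p (i C k) ⟨
    i C k + c            ∎)
    where
    open ≈-Reasoning p
    c = (p ∸ 1) * (i C k)
    -- e_k − C(i, k), the subtraction written as + (p − 1) C(i, k)
    g : Poly n
    g = elementary n k ++ constant c
    deg-g : DegLe g d
    deg-g = DegLe-++ (DegLe-weaken k≤d (DegLe-elementary n k)) (DegLe-constant c)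
    g-value : ∀ x → evalPoly g (bits x) ≡ weight x C k + c
    g-value x = trans (evalPoly-++ (elementary n k) (constant c) (bits x))
                      (cong₂ _+_ (evalPoly-elementary n k x) (evalPoly-constant c x))
    g-vanishes : ∀ x → Slice i x → VanishesAt p g x
    g-vanishes x refl = ≈0⇒∣ (≈-trans (≈-reflexive (g-value x)) (a+[p∸1]*a≈0 p (i C k)))

  ZCl-weight-≤ : ∀ {n d i} {y : Vec Bool n} → i < d → ZCl p n d (Slice i) y → weight y ≤ i
  ZCl-weight-≤ {n} {d} {i} {y} i<d y∈cl with weight y ≤? i
  ... | yes w≤i = w≤i
  ... | no  w≰i = ⊥-elim (p∤1 (subst (p ∣_) f-at-y (y∈cl f deg-f f-vanishes)))
    where
    A = subvectorOfWeight y (suc i)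
    wA≡1+i : weight A ≡ suc i
    wA≡1+i = subvectorOfWeight-weight y (≰⇒> w≰i)
    f = monomial A
    deg-f : DegLe f d
    deg-f = DegLe-weaken (subst (_≤ d) (sym wA≡1+i) i<d) (DegLe-monomial A)
    f-at-y : evalPoly f (bits y) ≡ 1
    f-at-y = trans (evalPoly-monomial A y) (cong bit (subvectorOfWeight-⊑ y (suc i)))
    f-vanishes : ∀ x → Slice i x → VanishesAt p f x
    f-vanishes x wx≡i with bits A ⊑ x in A⊑x
    ... | false = subst (p ∣_) (sym (trans (evalPoly-monomial A x) (cong bit A⊑x))) (p ∣0)
    ... | true  = ⊥-elim (<⇒≱ (≤-reflexive (sym wA≡1+i)) (begin
      weight A                ≡⟨ supportSize-bits A ⟨
      supportSize (bits A)    ≤⟨ ⊑⇒supportSize≤weight (bits A) x A⊑x ⟩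
      weight x                ≡⟨ wx≡i ⟩
      i                       ∎))
      where open ≤-Reasoning

  ZCl-weight-≥ : ∀ {n d i} {y : Vec Bool n} → i < d → ZCl p n d (Slice i) y → i ≤ weight y
  ZCl-weight-≥ {n} {d} {i} {y} i<d y∈cl with i ≤? weight y
  ... | yes i≤w = i≤w
  ... | no  i≰w = ⊥-elim (p∤1 (subst (p ∣_) f-at-y (y∈cl f deg-f f-vanishes)))
    where
    w<i = ≰⇒> i≰w
    s = i ∸ weight y
    w+s≡i : weight y + s ≡ i
    w+s≡i = m+[n∸m]≡n (<⇒≤ w<i)
    f = aboveIndicator p y s
    deg-f : DegLe f d
    deg-f = DegLe-weaken (≤-trans (≤-reflexive w+s≡i) (<⇒≤ i<d)) (DegLe-aboveIndicator p y s)
    f-at-y : evalPoly f (bits y) ≡ 1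
    f-at-y = trans (evalPoly-aboveIndicator-⊑ p y s y (bits-⊑-refl y) (≤-trans (≤-reflexive (excess-self y)) z≤n))
                   (cong (p ^_) (excess-self y))
    f-vanishes : ∀ x → Slice i x → VanishesAt p f x
    f-vanishes x wx≡i with bits y ⊑ x in y⊑x
    ... | false = subst (p ∣_) (sym (evalPoly-aboveIndicator-⋢ p y s x y⊑x)) (p ∣0)
    ... | true  = subst (p ∣_) (sym (trans (evalPoly-aboveIndicator-⊑ p y s x y⊑x (≤-reflexive e≡s)) (cong (p ^_) e≡s)))
                        (p∣p^s s (m<n⇒0<n∸m w<i))
      where
      e≡s : excess y x ≡ s
      e≡s = +-cancelˡ-≡ (weight y) _ _ (trans (sym (weight-excess y x y⊑x)) (trans wx≡i (sym w+s≡i)))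
      p∣p^s : ∀ s → 0 < s → p ∣ p ^ s
      p∣p^s (suc s) _ = divides (p ^ s) (*-comm p _)

  ZCl-small-slice : ∀ {n d i} {y : Vec Bool n} → i < d → ZCl p n d (Slice i) y → weight y ≡ i
  ZCl-small-slice i<d y∈cl = ≤-antisym (ZCl-weight-≤ i<d y∈cl) (ZCl-weight-≥ i<d y∈cl)

  ZCl-outer-slice : ∀ {n d i} {y : Vec Bool n} → i ≤ n → i < d ⊎ n ∸ d < i → ZCl p n d (Slice i) y → weight y ≡ i
  ZCl-outer-slice i≤n (inj₁ i<d) y∈cl = ZCl-small-slice i<d y∈cl
  ZCl-outer-slice {n} {d} {i} {y} i≤n (inj₂ n∸d<i) y∈cl = begin
    weight y                   ≡⟨ m∸[m∸n]≡n (weight-≤ y) ⟨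
    n ∸ (n ∸ weight y)         ≡⟨ cong (n ∸_) (weight-complement-∸ y) ⟨
    n ∸ weight (complement y)  ≡⟨ cong (n ∸_) (ZCl-small-slice n∸i<d (ZCl-complement y∈cl)) ⟩
    n ∸ (n ∸ i)                ≡⟨ m∸[m∸n]≡n i≤n ⟩
    i                          ∎
    where
    open ≡-Reasoning
    n∸i<d : n ∸ i < d
    n∸i<d = ∸-cancelʳ-< {o = n} (subst (n ∸ d <_) (sym (m∸[m∸n]≡n i≤n)) n∸d<i)

  ZCl-≈ : ∀ {n d i ℓ} {y : Vec Bool n} → (∀ {k} → k < ℓ → p ^ k ≤ d) → ZCl p n d (Slice i) y →
    weight y ≈[ p ^ ℓ ] i
  ZCl-≈ {ℓ = ℓ} p^k≤d y∈cl = ≈-from-binomial-digits pp ℓ (λ k<ℓ → ZCl-binomial (p^k≤d k<ℓ) y∈cl)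

infix 4 _∈_⊕_
_∈_⊕_ : ℕ → ℕ → ℕ → Set
t ∈ s ⊕ m = (∃ λ q → t ≡ s + q * m) ⊎ (∃ λ q → s ≡ t + q * m)

∈⊕-above : ∀ {m s t} → s < m → t ∈ s ⊕ m → ∃ λ q → t ≡ s + q * m
∈⊕-above _   (inj₁ t≡s+qm)             = t≡s+qm
∈⊕-above _   (inj₂ (zero , s≡t+0))     = 0 , trans (sym (+-identityʳ _)) (trans (sym s≡t+0) (sym (+-identityʳ _)))
∈⊕-above {m} {s} {t} s<m (inj₂ (suc q , s≡t+[m+qm])) =
  ⊥-elim (<⇒≱ s<m (subst (m ≤_) (sym s≡t+[m+qm]) (≤-trans (m≤m+n m (q * m)) (m≤n+m _ t))))

∈⊕-complement : ∀ {m a b s t} → a + t ≡ s + b → t ∈ s ⊕ m → a ∈ b ⊕ m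
∈⊕-complement {m} {a} {b} {s} {t} a+t≡s+b (inj₁ (q , t≡s+qm)) =
  inj₂ (q , +-cancelˡ-≡ s _ _ (sym (trans (shuffle s a (q * m)) (trans (cong (a +_) (sym t≡s+qm)) a+t≡s+b))))
  where
  shuffle : ∀ s a r → s + (a + r) ≡ a + (s + r)
  shuffle = solve-∀
∈⊕-complement {m} {a} {b} {s} {t} a+t≡s+b (inj₂ (q , s≡t+qm)) =
  inj₁ (q , +-cancelˡ-≡ t _ _ (trans (+-comm t a) (trans a+t≡s+b (trans (cong (_+ b) s≡t+qm) (shuffle t (q * m) b)))))
  where
  shuffle : ∀ t r b → t + r + b ≡ t + (b + r)
  shuffle = solve-∀

∣t-i∣≡t∸i : ∀ {t i} → i ≤ t → ℤ.∣ ℤ.+ t ℤ.- ℤ.+ i ∣ ≡ t ∸ i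
∣t-i∣≡t∸i {t} {i} i≤t = trans (cong ℤ.∣_∣ (ℤP.m-n≡m⊖n t i)) (trans (ℤP.∣m⊖n∣≡∣n⊖m∣ t i) (ℤP.∣⊖∣-≤ i≤t))

∣t-i∣≡i∸t : ∀ {t i} → t ≤ i → ℤ.∣ ℤ.+ t ℤ.- ℤ.+ i ∣ ≡ i ∸ t
∣t-i∣≡i∸t {t} {i} t≤i = trans (cong ℤ.∣_∣ (ℤP.m-n≡m⊖n t i)) (ℤP.∣⊖∣-≤ t≤i)

≈⇒≡[mod] : ∀ {M t i} → t ≈[ M ] i → t ≡ i [mod M ]
≈⇒≡[mod] {M} {t} {i} t≈i with ≤-total i t
... | inj₁ i≤t = subst (M ∣_) (sym (∣t-i∣≡t∸i i≤t))
                       (≈0⇒∣ (≈-+-cancelʳ i (≈-trans (≈-reflexive (m∸n+n≡m i≤t)) t≈i)))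
... | inj₂ t≤i = subst (M ∣_) (sym (∣t-i∣≡i∸t t≤i))
                       (≈0⇒∣ (≈-+-cancelʳ t (≈-trans (≈-reflexive (m∸n+n≡m t≤i)) (≈-sym t≈i))))

≡[mod]⇒∈⊕ : ∀ {M t i} → t ≡ i [mod M ] → t ∈ i ⊕ M
≡[mod]⇒∈⊕ {M} {t} {i} t≡i with ≤-total i t
... | inj₁ i≤t with subst (M ∣_) (∣t-i∣≡t∸i i≤t) t≡i
...   | divides q t∸i≡qM = inj₁ (q , trans (sym (m+[n∸m]≡n i≤t)) (cong (i +_) t∸i≡qM))
≡[mod]⇒∈⊕ {M} {t} {i} t≡i | inj₂ t≤i with subst (M ∣_) (∣t-i∣≡i∸t t≤i) t≡i
...   | divides q i∸t≡qM = inj₂ (q , trans (sym (m+[n∸m]≡n t≤i)) (cong (t +_) i∸t≡qM))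

∈⊕-pred : ∀ {m s t} → suc t ∈ suc s ⊕ m → t ∈ s ⊕ m
∈⊕-pred (inj₁ (q , e)) = inj₁ (q , suc-injective e)
∈⊕-pred (inj₂ (q , e)) = inj₂ (q , suc-injective e)

module _ {p m d : ℕ} .{{_ : NonZero p}} (inner : InnerBinomialsDivisible p m) (d<m : d < m) where

  countContaining-≈ : ∀ {n} (e : Vec ℕ n) {y} q → monoDeg e ≤ d → weight y ≡ d + q * m →
    countContaining e y d ≈[ p ] bit (e ⊑ y)
  countContaining-≈ e {y} q deg≤d wy≡d+qm with e ⊑ y in e⊑y
  ... | false = ≈-reflexive (countContaining-⋢ e y d e⊑y)
  ... | true  = begin
    countContaining e y d  ≡⟨ countContaining-⊑ e y e⊑y wy≡a+[j+qm] d≡a+j ⟩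
    (j + q * m) C j        ≈⟨ C-periodic inner q j j<m ⟩
    j C j                  ≡⟨ nCn≡1 j ⟩
    1                      ∎
    where
    open ≈-Reasoning p
    a = supportSize e
    j = d ∸ a
    d≡a+j : d ≡ a + j
    d≡a+j = sym (m+[n∸m]≡n (≤-trans (supportSize-≤ e) deg≤d))
    wy≡a+[j+qm] : weight y ≡ a + (j + q * m)
    wy≡a+[j+qm] = trans wy≡d+qm (trans (cong (_+ q * m) d≡a+j) (+-assoc a j (q * m)))
    j<m : j < m
    j<m = ≤-<-trans (m∸n≤m d a) d<m

  ZCl-bottom : ∀ {n} {y : Vec Bool n} q → weight y ≡ d + q * m → ZCl p n d (Slice d) y
  ZCl-bottom {n} {y} q wy≡d+qm f deg-f f-vanishes = ≈0⇒∣ (begin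
    evalPoly f (bits y)                                  ≡⟨ evalPoly-bits f y ⟩
    ∑ f (λ t → proj₁ t * bit (proj₂ t ⊑ y))              ≈⟨ ∑-≈ (All.map (λ {t} → term {t}) deg-f) ⟨
    ∑ f (λ t → proj₁ t * countContaining (proj₂ t) y d)  ≡⟨ ∑-cong f (λ t → ∑-*ˡ xs (proj₁ t) _) ⟨
    ∑ f (λ t → ∑ xs (λ x → proj₁ t * bit (proj₂ t ⊑ x))) ≡⟨ ∑-comm xs f _ ⟨
    ∑ xs (λ x → ∑ f (λ t → proj₁ t * bit (proj₂ t ⊑ x))) ≡⟨ ∑-cong xs (λ x → evalPoly-bits f x) ⟨
    ∑ xs (λ x → evalPoly f (bits x))                     ≈⟨ ∑-≈ (All.map (λ {x} wx → ∣⇒≈0 (f-vanishes x wx)) (subsetsOfSize-weight y d)) ⟩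
    ∑ xs (λ _ → 0)                                       ≡⟨ ∑-zero (All.universal (λ _ → refl) xs) ⟩
    0                                                    ∎)
    where
    open ≈-Reasoning p
    xs = subsetsOfSize y d
    term : ∀ {t} → monoDeg (proj₂ t) ≤ d → proj₁ t * countContaining (proj₂ t) y d ≈[ p ] proj₁ t * bit (proj₂ t ⊑ y)
    term {t} deg≤d = ≈-*ˡ (proj₁ t) (countContaining-≈ (proj₂ t) q deg≤d wy≡d+qm)

  ZCl-top : ∀ {n s} {y : Vec Bool n} → s + d ≡ n → weight y ∈ s ⊕ m → ZCl p n d (Slice s) y
  ZCl-top {n} {s} {y} s+d≡n wy∈s⊕m =
    subst₂ (λ i z → ZCl p n d (Slice i) z) n∸d≡s (complement-involutive y)
           (ZCl-complement (ZCl-bottom (proj₁ above) (proj₂ above)))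
    where
    above : ∃ λ q → weight (complement y) ≡ d + q * m
    above = ∈⊕-above d<m (∈⊕-complement (trans (weight-complement y) (sym s+d≡n)) wy∈s⊕m)
    n∸d≡s : n ∸ d ≡ s
    n∸d≡s = trans (cong (_∸ d) (sym s+d≡n)) (m+n∸n≡m s d)

  ZCl-⊕ : ∀ n {s} {y : Vec Bool n} → d ≤ s → s + d ≤ n → weight y ∈ s ⊕ m → ZCl p n d (Slice s) y
  ZCl-interior : ∀ n {s} {y : Vec Bool n} → d < s → s + d < n → weight y ∈ s ⊕ m → ZCl p n d (Slice s) y

  ZCl-⊕ n {s} d≤s s+d≤n wy∈s⊕m with s ≟ d | s + d ≟ n
  ... | yes refl | _          = ZCl-bottom (proj₁ above) (proj₂ above)
    where above = ∈⊕-above d<m wy∈s⊕m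
  ... | no _     | yes s+d≡n  = ZCl-top s+d≡n wy∈s⊕m
  ... | no s≢d   | no s+d≢n   = ZCl-interior n (≤∧≢⇒< d≤s (s≢d ∘ sym)) (≤∧≢⇒< s+d≤n s+d≢n) wy∈s⊕m

  ZCl-interior (suc n) {y = false ∷ y} d<s s+d<n wy∈s⊕m =
    ZCl-false∷ (ZCl-⊕ n (<⇒≤ d<s) (≤-pred s+d<n) wy∈s⊕m)
  ZCl-interior (suc n) {suc s} {true ∷ y} d<s s+d<n wy∈s⊕m =
    ZCl-true∷ (ZCl-⊕ n (≤-pred d<s) (<⇒≤ (≤-pred s+d<n)) (∈⊕-pred wy∈s⊕m))

theorem1p5 : (p : ℕ) → Prime p → (n : ℕ) → 1 ≤ n → (i d ℓ : ℕ) → i ≤ n → d ≤ n →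
    IsCeilLog p d ℓ →
    ((i < d ⊎ n ∸ d < i) → (t : ℕ) → ZClW p n d (λ w → w ≡ i) t ⇔ (t ≡ i)) ×
    ((d ≤ i × i ≤ n ∸ d) → (t : ℕ) → ZClW p n d (λ w → w ≡ i) t ⇔ (t ≤ n × t ≡ i [mod p ^ ℓ ]))
theorem1p5 p pp n _ i d ℓ i≤n d≤n (d<p^ℓ , p^k<1+d) = outside , inside
  where
  instance _ = prime⇒nonZero pp

  outside : (i < d ⊎ n ∸ d < i) → (t : ℕ) → ZClW p n d (λ w → w ≡ i) t ⇔ (t ≡ i)
  outside i∉[d,n∸d] t = mk⇔
    (λ { (y , refl , y∈cl) → ZCl-outer-slice pp i≤n i∉[d,n∸d] y∈cl })
    (λ { refl → ZClW-extensive {E = _≡ i} i≤n refl })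

  inside : (d ≤ i × i ≤ n ∸ d) → (t : ℕ) → ZClW p n d (λ w → w ≡ i) t ⇔ (t ≤ n × t ≡ i [mod p ^ ℓ ])
  inside (d≤i , i≤n∸d) t = mk⇔
    (λ { (y , refl , y∈cl) → weight-≤ y , ≈⇒≡[mod] (ZCl-≈ pp (λ {k} k<ℓ → ≤-pred (p^k<1+d k k<ℓ)) y∈cl) })
    (λ { (t≤n , t≡i) → ZClW-⊕ t≤n (≡[mod]⇒∈⊕ t≡i) })
    where
    ZClW-⊕ : t ≤ n → t ∈ i ⊕ p ^ ℓ → ZClW p n d (λ w → w ≡ i) t
    ZClW-⊕ t≤n t∈i⊕p^ℓ with vectorOfWeight n t≤n
    ... | y , refl = y , refl , ZCl-⊕ (prime-power-innerBinomialsDivisible pp ℓ) d<p^ℓ n d≤i i+d≤n t∈i⊕p^ℓ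
      where
      i+d≤n : i + d ≤ n
      i+d≤n = ≤-trans (+-monoˡ-≤ d i≤n∸d) (≤-reflexive (m∸n+n≡m d≤n))
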